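{- Let $\omega=e^{2\pi i/3}$ and let $\alpha\in\mathbb{Z}[\omega]$ be an odd norm-perfect Eisenstein integer. For $j\in\{1,2\}$ let $P_j=\{\psi\in\mathbb{P}^+:\ \psi\equiv j \pmod{1-\omega^2},\ \psi\mid\alpha\}$. Then $\alpha$ has the form $$\alpha=\varepsilon\,\psi_0^k\prod_{\psi_1\in P_1,\,\psi_1\ne\psi_0}\psi_1^{e_{\psi_1}}\prod_{\psi_2\in P_2,\,\psi_2\ne\psi_0}\psi_2^{e_{\psi_2}}$$ with $\varepsilon$ a unit, where either (1) $\psi_0\in P_1$ and $k\equiv 2\pmod 3$, or (2) $\psi_0\in P_2$ and $k\equiv 1\pmod 2$; and moreover $e_{\psi_1}\not\equiv 2\pmod 3$ for all the $\psi_1$ in the product and $e_{\psi_2}\equiv 0\pmod 2$ for all the $\psi_2$ in the product.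
   Context: $\mathbb{Z}[\omega]$ is a UFD with norm $N(a+b\omega)=a^2-ab+b^2$, and $\mathbb{Z}[\omega]/(1-\omega^2)\cong\mathbb{Z}/3\mathbb{Z}$. The positive primes are $\mathbb{P}^+=\{a+b\omega: a>b\ge 0\}\cap\{\text{primes of }\mathbb{Z}[\omega]\}$. For nonzero $\alpha=\varepsilon\prod\pi_j^{e_j}$ ($\varepsilon$ a unit, distinct $\pi_j\in\mathbb{P}^+$), $\sigma(\alpha)=\prod\frac{\pi_j^{e_j+1}-1}{\pi_j-1}$. $\alpha$ is odd if $(1-\omega^2)\nmid\alpha$. $\alpha$ is norm-perfect if $N(\sigma(\alpha))=3N(\alpha)$. -}

module Defs where

open import Data.Nat as ℕ using (ℕ; zero; suc)
open import Data.Integer as ℤ using (ℤ; +_)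
open import Data.Product using (Σ; ∃; _×_; _,_; proj₁; proj₂)
open import Data.Sum using (_⊎_)
open import Data.List using (List; []; _∷_; map)
open import Data.List.Relation.Unary.All using (All)
open import Data.List.Relation.Unary.Unique.Propositional using (Unique)
open import Data.List.Membership.Propositional using (_∈_)
open import Relation.Binary.PropositionalEquality using (_≡_; _≢_)
open import Relation.Nullary using (¬_)

-- Eisenstein integers a + b ω, with ω² = -1 - ω (ω = e^{2πi/3}).
record 𝔼 : Set where
  constructor mkE
  field
    re : ℤ
    im : ℤ
open 𝔼 public

infixl 6 _+ᴱ_ _-ᴱ_
infixl 7 _*ᴱ_
infixr 8 _^ᴱ_

_+ᴱ_ : 𝔼 → 𝔼 → 𝔼
mkE a b +ᴱ mkE c d = mkE (a ℤ.+ c) (b ℤ.+ d)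

-ᴱ_ : 𝔼 → 𝔼
-ᴱ mkE a b = mkE (ℤ.- a) (ℤ.- b)

_-ᴱ_ : 𝔼 → 𝔼 → 𝔼
x -ᴱ y = x +ᴱ (-ᴱ y)

-- (a + bω)(c + dω) = (ac - bd) + (ad + bc - bd) ω
_*ᴱ_ : 𝔼 → 𝔼 → 𝔼
mkE a b *ᴱ mkE c d = mkE (a ℤ.* c ℤ.- b ℤ.* d) (a ℤ.* d ℤ.+ b ℤ.* c ℤ.- b ℤ.* d)

0ᴱ 1ᴱ ω : 𝔼
0ᴱ = mkE (+ 0) (+ 0)
1ᴱ = mkE (+ 1) (+ 0)
ω  = mkE (+ 0) (+ 1)

fromℕᴱ : ℕ → 𝔼
fromℕᴱ n = mkE (+ n) (+ 0)

_^ᴱ_ : 𝔼 → ℕ → 𝔼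
x ^ᴱ zero  = 1ᴱ
x ^ᴱ suc n = x *ᴱ (x ^ᴱ n)

N : 𝔼 → ℤ
N (mkE a b) = a ℤ.* a ℤ.- a ℤ.* b ℤ.+ b ℤ.* b

_∣ᴱ_ : 𝔼 → 𝔼 → Set
x ∣ᴱ y = ∃ λ c → y ≡ x *ᴱ c

IsUnit : 𝔼 → Set
IsUnit u = ∃ λ v → u *ᴱ v ≡ 1ᴱ

IsPrime : 𝔼 → Set
IsPrime π = π ≢ 0ᴱ × ¬ IsUnit π × (∀ x y → π ∣ᴱ (x *ᴱ y) → π ∣ᴱ x ⊎ π ∣ᴱ y)

PositivePrime : 𝔼 → Set
PositivePrime π = IsPrime π × (im π ℤ.< re π) × (+ 0 ℤ.≤ im π)

λ₃ : 𝔼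
λ₃ = 1ᴱ -ᴱ ω *ᴱ ω

_≡_mod-λ₃ : 𝔼 → 𝔼 → Set
x ≡ y mod-λ₃ = λ₃ ∣ᴱ (x -ᴱ y)

Odd : 𝔼 → Set
Odd α = ¬ (λ₃ ∣ᴱ α)

prodPow : List (𝔼 × ℕ) → 𝔼
prodPow []            = 1ᴱ
prodPow ((π , e) ∷ l) = (π ^ᴱ e) *ᴱ prodPow l

geomSum : 𝔼 → ℕ → 𝔼
geomSum π zero    = 1ᴱ
geomSum π (suc e) = geomSum π e +ᴱ π ^ᴱ suc e

record Factorization (α : 𝔼) : Set where
  field
    unit       : 𝔼
    unit-unit  : IsUnit unit
    factors    : List (𝔼 × ℕ)
    factors-ok : All (λ p → PositivePrime (proj₁ p) × 1 ℕ.≤ proj₂ p) factors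
    distinct   : Unique (map proj₁ factors)
    factors-eq : α ≡ unit *ᴱ prodPow factors

-- σ(α) = ∏ (πⱼ^{eⱼ+1} - 1)/(πⱼ - 1), computed from a factorization
σ-list : List (𝔼 × ℕ) → 𝔼
σ-list []            = 1ᴱ
σ-list ((π , e) ∷ l) = geomSum π e *ᴱ σ-list l

σ : ∀ {α} → Factorization α → 𝔼
σ F = σ-list (Factorization.factors F)

NormPerfect : 𝔼 → Set
NormPerfect α = Σ (Factorization α) λ F → N (σ F) ≡ + 3 ℤ.* N α

InP : ℕ → 𝔼 → 𝔼 → Set
InP j α ψ = PositivePrime ψ × (ψ ≡ fromℕᴱ j mod-λ₃) × ψ ∣ᴱ α

Enumerates : (𝔼 → Set) → List 𝔼 → Set
Enumerates Q L = Unique L × (∀ ψ → (ψ ∈ L → Q ψ) × (Q ψ → ψ ∈ L))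

prodExp : List 𝔼 → (𝔼 → ℕ) → 𝔼
prodExp []      e = 1ᴱ
prodExp (ψ ∷ L) e = (ψ ^ᴱ e ψ) *ᴱ prodExp L e

-- Reduction modulo λ₃ = 1 − ω² is a ring map ℤ[ω] → 𝔽₃, a + bω ↦ a + b, with kernel (λ₃), and
-- N(a + bω) = (a + b)² − 3ab.  So for odd α we have 3 ∤ N(α), and N(σ(α)) = 3 N(α) says exactly
-- that λ₃ ∣ σ(α) but λ₃² ∤ σ(α).  Since σ(α) is the product of the σ(ψᵉ) = 1 + ψ + ⋯ + ψᵉ and λ₃
-- is prime, exactly one of these factors, σ(ψ₀ᵏ), is divisible by λ₃.  Every prime ψ ∣ α is
-- ≡ 1 or ≡ 2 ≡ −1 modulo λ₃, so σ(ψᵉ) ≡ e + 1, resp. ≡ 1 − 1 + ⋯ ± 1, which vanishes iff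
-- e ≡ 2 (mod 3), resp. iff e is odd; this gives the conditions on k and on all other exponents.
-- That the prime factors of the factorization enumerate P₁ and P₂ rests on unique factorization:
-- a positive prime dividing α divides some ψᵉ, hence equals ψ, because two distinct associates
-- never both lie in the sector a > b ≥ 0.
module Submission where

open import Defs
open import Algebra.Bundles using (CommutativeSemigroup)
import Algebra.Properties.CommutativeSemigroup as CommutativeSemigroupProperties
open import Data.Empty using (⊥-elim)
open import Data.Integer as ℤ using (ℤ; +_; -[1+_]; ∣_∣; _+_; _-_; _*_; -_; _<_; _≤_)
open import Data.Integer.Divisibility.Signed
  using (_∣_; divides; _∣?_; ∣-refl; ∣m∣n⇒∣m+n; ∣m∣n⇒∣m-n; ∣n⇒∣m*n; ∣m⇒∣m*n)
import Data.Integer.Properties as ℤP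
open import Data.Integer.Tactic.RingSolver using (solve; solve-∀)
open import Data.List using (List; []; _∷_; map; filter)
import Data.List.Relation.Unary.All as All
import Data.List.Relation.Unary.AllPairs as AllPairs
open import Data.List.Relation.Unary.Any using (here; there)
open import Data.List.Relation.Unary.Unique.Propositional using (Unique)
import Data.List.Relation.Unary.Unique.Propositional.Properties as Unique
open import Data.List.Membership.Propositional using (_∈_)
open import Data.List.Membership.Propositional.Properties using (∈-map⁺; ∈-map⁻; ∈-filter⁺; ∈-filter⁻)
open import Data.List.Properties using (filter-accept; filter-reject; filter-none)
open import Data.Nat as ℕ using (ℕ; zero; suc; _%_; s≤s; z≤n)
import Data.Nat.Properties as ℕP
open import Data.Product using (Σ; ∃; _×_; _,_; proj₁; proj₂; uncurry)
open import Data.Sum as Sum using (_⊎_; inj₁; inj₂)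
open import Function using (_∘_; id; flip; case_of_; _⇔_; mk⇔; Equivalence)
open import Function.Construct.Composition using (_⇔-∘_)
open import Function.Construct.Symmetry using (⇔-sym)
open import Level using (0ℓ)
open import Relation.Binary.Definitions using (DecidableEquality)
open import Relation.Binary.PropositionalEquality
open import Relation.Nullary using (¬_; contradiction; yes; no)
open import Relation.Nullary.Decidable using (False; toWitnessFalse; from-no; map′; ¬?; _×-dec_)
open import Relation.Unary using (Pred; Decidable)

open Equivalence using (to; from)

-- Arithmetic of ℤ[ω]

*ᴱ-comm : ∀ x y → x *ᴱ y ≡ y *ᴱ x
*ᴱ-comm (mkE a b) (mkE c d) = cong₂ mkE (solve (a ∷ b ∷ c ∷ d ∷ [])) (solve (a ∷ b ∷ c ∷ d ∷ []))

*ᴱ-assoc : ∀ x y z → (x *ᴱ y) *ᴱ z ≡ x *ᴱ (y *ᴱ z)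
*ᴱ-assoc (mkE a b) (mkE c d) (mkE e f) = cong₂ mkE (re-assoc a b c d e f) (im-assoc a b c d e f)
  where
  re-assoc : ∀ a b c d e f →
    (a * c - b * d) * e - (a * d + b * c - b * d) * f ≡ a * (c * e - d * f) - b * (c * f + d * e - d * f)
  re-assoc = solve-∀
  im-assoc : ∀ a b c d e f →
    (a * c - b * d) * f + (a * d + b * c - b * d) * e - (a * d + b * c - b * d) * f
      ≡ a * (c * f + d * e - d * f) + b * (c * e - d * f) - b * (c * f + d * e - d * f)
  im-assoc = solve-∀

*ᴱ-identityʳ : ∀ x → x *ᴱ 1ᴱ ≡ x
*ᴱ-identityʳ (mkE a b) = cong₂ mkE (solve (a ∷ b ∷ [])) (solve (a ∷ b ∷ []))

*ᴱ-distribˡ--ᴱ : ∀ x y z → x *ᴱ (y -ᴱ z) ≡ x *ᴱ y -ᴱ x *ᴱ z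
*ᴱ-distribˡ--ᴱ (mkE a b) (mkE c d) (mkE e f) = cong₂ mkE (re-distrib a b c d e f) (im-distrib a b c d e f)
  where
  re-distrib : ∀ a b c d e f → a * (c - e) - b * (d - f) ≡ (a * c - b * d) - (a * e - b * f)
  re-distrib = solve-∀
  im-distrib : ∀ a b c d e f →
    a * (d - f) + b * (c - e) - b * (d - f) ≡ (a * d + b * c - b * d) - (a * f + b * e - b * f)
  im-distrib = solve-∀

x-ᴱx≡0ᴱ : ∀ x → x -ᴱ x ≡ 0ᴱ
x-ᴱx≡0ᴱ (mkE a b) = cong₂ mkE (ℤP.+-inverseʳ a) (ℤP.+-inverseʳ b)

x-ᴱy≡0ᴱ⇒x≡y : ∀ {x y} → x -ᴱ y ≡ 0ᴱ → x ≡ y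
x-ᴱy≡0ᴱ⇒x≡y {mkE a b} {mkE c d} x-y≡0 =
  cong₂ mkE (ℤP.i-j≡0⇒i≡j a c (cong re x-y≡0)) (ℤP.i-j≡0⇒i≡j b d (cong im x-y≡0))

*ᴱ-commutativeSemigroup : CommutativeSemigroup 0ℓ 0ℓ
*ᴱ-commutativeSemigroup = record
  { Carrier                = 𝔼
  ; _≈_                    = _≡_
  ; _∙_                    = _*ᴱ_
  ; isCommutativeSemigroup = record
    { isSemigroup = record
      { isMagma = record { isEquivalence = isEquivalence ; ∙-cong = cong₂ _*ᴱ_ }
      ; assoc   = *ᴱ-assoc
      }
    ; comm = *ᴱ-comm
    }
  }

open CommutativeSemigroupProperties *ᴱ-commutativeSemigroup using (x∙yz≈y∙xz; interchange)

N-* : ∀ x y → N (x *ᴱ y) ≡ N x * N y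
N-* (mkE a b) (mkE c d) = multiplicative a b c d
  where
  multiplicative : ∀ a b c d →
    let u = a * c - b * d; v = a * d + b * c - b * d
    in u * u - u * v + v * v ≡ (a * a - a * b + b * b) * (c * c - c * d + d * d)
  multiplicative = solve-∀

N-swap : ∀ a b → N (mkE a b) ≡ N (mkE b a)
N-swap a b = symmetric a b
  where
  symmetric : ∀ a b → a * a - a * b + b * b ≡ b * b - b * a + a * a
  symmetric = solve-∀

i*i≡+∣i∣*∣i∣ : ∀ i → i * i ≡ + (∣ i ∣ ℕ.* ∣ i ∣)
i*i≡+∣i∣*∣i∣ (+ n)    = ℤP.+◃n≡+n (n ℕ.* n)
i*i≡+∣i∣*∣i∣ -[1+ n ] = refl

4N≡∣2a-b∣²+3∣b∣² : ∀ a b → + 4 * N (mkE a b) ≡ + (∣ + 2 * a - b ∣ ℕ.* ∣ + 2 * a - b ∣ ℕ.+ 3 ℕ.* (∣ b ∣ ℕ.* ∣ b ∣))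
4N≡∣2a-b∣²+3∣b∣² a b = begin
  + 4 * N (mkE a b)                                   ≡⟨ completed-square a b ⟩
  X * X + + 3 * (b * b)                               ≡⟨ cong₂ (λ u v → u + + 3 * v) (i*i≡+∣i∣*∣i∣ X) (i*i≡+∣i∣*∣i∣ b) ⟩
  + (∣ X ∣ ℕ.* ∣ X ∣) + + 3 * + (∣ b ∣ ℕ.* ∣ b ∣)     ≡⟨ cong (λ t → + (∣ X ∣ ℕ.* ∣ X ∣) + t) (ℤP.pos-* 3 (∣ b ∣ ℕ.* ∣ b ∣)) ⟨
  + (∣ X ∣ ℕ.* ∣ X ∣) + + (3 ℕ.* (∣ b ∣ ℕ.* ∣ b ∣))   ≡⟨ ℤP.pos-+ (∣ X ∣ ℕ.* ∣ X ∣) (3 ℕ.* (∣ b ∣ ℕ.* ∣ b ∣)) ⟨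
  + (∣ X ∣ ℕ.* ∣ X ∣ ℕ.+ 3 ℕ.* (∣ b ∣ ℕ.* ∣ b ∣))     ∎
  where
  open ≡-Reasoning
  X : ℤ
  X = + 2 * a - b
  completed-square : ∀ a b → + 4 * (a * a - a * b + b * b) ≡ (+ 2 * a - b) * (+ 2 * a - b) + + 3 * (b * b)
  completed-square = solve-∀

N≡+∣N∣ : ∀ x → N x ≡ + ∣ N x ∣
N≡+∣N∣ (mkE a b) with N (mkE a b) | 4N≡∣2a-b∣²+3∣b∣² a b
... | + n      | _  = refl
... | -[1+ n ] | ()

3∣b∣²≤4N : ∀ a b {n} → N (mkE a b) ≡ + n → 3 ℕ.* (∣ b ∣ ℕ.* ∣ b ∣) ℕ.≤ 4 ℕ.* n
3∣b∣²≤4N a b {n} Nx≡n = begin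
  3 ℕ.* ∣b∣²                      ≤⟨ ℕP.m≤n+m (3 ℕ.* ∣b∣²) (∣ X ∣ ℕ.* ∣ X ∣) ⟩
  ∣ X ∣ ℕ.* ∣ X ∣ ℕ.+ 3 ℕ.* ∣b∣²  ≡⟨ ℤP.+-injective 4N≡4n ⟩
  4 ℕ.* n                         ∎
  where
  open ℕP.≤-Reasoning
  X : ℤ
  X = + 2 * a - b
  ∣b∣² : ℕ
  ∣b∣² = ∣ b ∣ ℕ.* ∣ b ∣
  4N≡4n : + (∣ X ∣ ℕ.* ∣ X ∣ ℕ.+ 3 ℕ.* ∣b∣²) ≡ + (4 ℕ.* n)
  4N≡4n = trans (sym (4N≡∣2a-b∣²+3∣b∣² a b)) (trans (cong (+ 4 *_) Nx≡n) (sym (ℤP.pos-* 4 n)))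

3n²≤0⇒n≡0 : ∀ n → 3 ℕ.* (n ℕ.* n) ℕ.≤ 0 → n ≡ 0
3n²≤0⇒n≡0 zero    _  = refl
3n²≤0⇒n≡0 (suc n) ()

3n²≤4⇒n≤1 : ∀ n → 3 ℕ.* (n ℕ.* n) ℕ.≤ 4 → n ℕ.≤ 1
3n²≤4⇒n≤1 zero          _     = z≤n
3n²≤4⇒n≤1 (suc zero)    _     = s≤s z≤n
3n²≤4⇒n≤1 (suc (suc k)) 3n²≤4 = contradiction (ℕP.≤-trans 12≤3n² 3n²≤4) (from-no (12 ℕ.≤? 4))
  where
  12≤3n² : 12 ℕ.≤ 3 ℕ.* (suc (suc k) ℕ.* suc (suc k))
  12≤3n² = ℕP.*-monoʳ-≤ 3 (ℕP.*-mono-≤ (s≤s (s≤s (z≤n {k}))) (s≤s (s≤s (z≤n {k}))))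

N≡0⇒≡0ᴱ : ∀ x → N x ≡ + 0 → x ≡ 0ᴱ
N≡0⇒≡0ᴱ (mkE a b) Nx≡0 = cong₂ mkE (im≡0 b a (trans (N-swap b a) Nx≡0)) (im≡0 a b Nx≡0)
  where
  im≡0 : ∀ a b → N (mkE a b) ≡ + 0 → b ≡ + 0
  im≡0 a b = ℤP.∣i∣≡0⇒i≡0 ∘ 3n²≤0⇒n≡0 ∣ b ∣ ∘ 3∣b∣²≤4N a b

N≡1⇒∣im∣≤1 : ∀ a b → N (mkE a b) ≡ + 1 → ∣ b ∣ ℕ.≤ 1
N≡1⇒∣im∣≤1 a b = 3n²≤4⇒n≤1 ∣ b ∣ ∘ 3∣b∣²≤4N a b

IsUnit⇒N≡1 : ∀ {u} → IsUnit u → N u ≡ + 1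
IsUnit⇒N≡1 {u} (v , uv≡1) = trans (N≡+∣N∣ u) (cong +_ (ℕP.m*n≡1⇒m≡1 ∣ N u ∣ ∣ N v ∣ ∣Nu∣∣Nv∣≡1))
  where
  ∣Nu∣∣Nv∣≡1 : ∣ N u ∣ ℕ.* ∣ N v ∣ ≡ 1
  ∣Nu∣∣Nv∣≡1 = trans (sym (ℤP.abs-* (N u) (N v))) (cong ∣_∣ (trans (sym (N-* u v)) (cong N uv≡1)))

*ᴱ-zero-divisor : ∀ x y → x *ᴱ y ≡ 0ᴱ → x ≡ 0ᴱ ⊎ y ≡ 0ᴱ
*ᴱ-zero-divisor x y xy≡0 =
  Sum.map (N≡0⇒≡0ᴱ x) (N≡0⇒≡0ᴱ y) (ℤP.i*j≡0⇒i≡0∨j≡0 (N x) (trans (sym (N-* x y)) (cong N xy≡0)))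

x*y≡x⇒y≡1 : ∀ {x y} → x ≢ 0ᴱ → x *ᴱ y ≡ x → y ≡ 1ᴱ
x*y≡x⇒y≡1 {x} {y} x≢0 xy≡x =
  Sum.[ flip contradiction x≢0 , x-ᴱy≡0ᴱ⇒x≡y ]′ (*ᴱ-zero-divisor x (y -ᴱ 1ᴱ) x[y-1]≡0)
  where
  open ≡-Reasoning
  x[y-1]≡0 : x *ᴱ (y -ᴱ 1ᴱ) ≡ 0ᴱ
  x[y-1]≡0 = begin
    x *ᴱ (y -ᴱ 1ᴱ)     ≡⟨ *ᴱ-distribˡ--ᴱ x y 1ᴱ ⟩
    x *ᴱ y -ᴱ x *ᴱ 1ᴱ  ≡⟨ cong₂ _-ᴱ_ xy≡x (*ᴱ-identityʳ x) ⟩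
    x -ᴱ x             ≡⟨ x-ᴱx≡0ᴱ x ⟩
    0ᴱ                 ∎

∣ᴱ-refl : ∀ {x} → x ∣ᴱ x
∣ᴱ-refl {x} = 1ᴱ , sym (*ᴱ-identityʳ x)

∣ᴱ-trans : ∀ {x y z} → x ∣ᴱ y → y ∣ᴱ z → x ∣ᴱ z
∣ᴱ-trans {x} (c , refl) (d , refl) = c *ᴱ d , *ᴱ-assoc x c d

∣n⇒∣m*ᴱn : ∀ {x y} z → x ∣ᴱ y → x ∣ᴱ (z *ᴱ y)
∣n⇒∣m*ᴱn {x} z (c , refl) = z *ᴱ c , x∙yz≈y∙xz z x c

*ᴱ-mono-∣ᴱ : ∀ {a b x y} → a ∣ᴱ x → b ∣ᴱ y → (a *ᴱ b) ∣ᴱ (x *ᴱ y)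
*ᴱ-mono-∣ᴱ {a} {b} (c , refl) (d , refl) = c *ᴱ d , ac·bd≡ab·cd
  where
  ac·bd≡ab·cd : (a *ᴱ c) *ᴱ (b *ᴱ d) ≡ (a *ᴱ b) *ᴱ (c *ᴱ d)
  ac·bd≡ab·cd = interchange a c b d

∣unit⇒unit : ∀ {x u} → x ∣ᴱ u → IsUnit u → IsUnit x
∣unit⇒unit {x} (c , refl) (v , xcv≡1) = c *ᴱ v , trans (sym (*ᴱ-assoc x c v)) xcv≡1

x∣x^n : ∀ x {n} → 1 ℕ.≤ n → x ∣ᴱ (x ^ᴱ n)
x∣x^n x {suc n} _ = x ^ᴱ n , refl

prime∣x^n⇒∣x : ∀ {p x} n → IsPrime p → p ∣ᴱ (x ^ᴱ n) → p ∣ᴱ x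
prime∣x^n⇒∣x {p} zero (_ , p-nonunit , _) p∣1 = contradiction (∣unit⇒unit {p} {1ᴱ} p∣1 (1ᴱ , refl)) p-nonunit
prime∣x^n⇒∣x {x = x} (suc n) p-prime@(_ , _ , p-euclid) p∣x^sn with p-euclid x (x ^ᴱ n) p∣x^sn
... | inj₁ p∣x   = p∣x
... | inj₂ p∣x^n = prime∣x^n⇒∣x n p-prime p∣x^n

data Trit : ℤ → Set where
  -1ₜ : Trit -[1+ 0 ]
  0ₜ  : Trit (+ 0)
  1ₜ  : Trit (+ 1)

trit : ∀ i → ∣ i ∣ ℕ.≤ 1 → Trit i
trit (+ 0)           _        = 0ₜ
trit (+ 1)           _        = 1ₜ
trit -[1+ 0 ]        _        = -1ₜ
trit (+ suc (suc n)) (s≤s ())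
trit -[1+ suc n ]    (s≤s ())

InSector : 𝔼 → Set
InSector x = im x < re x × + 0 ≤ im x

-- The units are the six elements with |re|, |im| ≤ 1 other than 0, 1 − ω and −1 + ω.  For each
-- u ≠ 1 among them, adding the sector inequalities of π and of π u yields L < R with L = R.
InSector-associate⇒≡ : ∀ {π u} → InSector π → N u ≡ + 1 → InSector (π *ᴱ u) → u ≡ 1ᴱ
InSector-associate⇒≡ {mkE a b} {mkE c d} (b<a , 0≤b) Nu≡1 =
  by-cases (trit c (N≡1⇒∣im∣≤1 d c (trans (N-swap d c) Nu≡1))) (trit d (N≡1⇒∣im∣≤1 c d Nu≡1)) Nu≡1
  where
  sum-−1 : ∀ a b → b + (a * + 0 + b * -[1+ 0 ] - b * + 0) ≡ a + (a * -[1+ 0 ] - b * + 0)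
  sum-−1 = solve-∀
  sum-ω : ∀ a b → (a * + 1 + b * + 0 - b * + 1) + b + + 0 ≡ (a * + 0 - b * + 1) + a + b
  sum-ω = solve-∀
  sum-1+ω : ∀ a b → (a * + 1 + b * + 1 - b * + 1) + + 0 ≡ (a * + 1 - b * + 1) + b
  sum-1+ω = solve-∀
  sum-−ω : ∀ a b → + 0 + b ≡ (a * -[1+ 0 ] + b * + 0 - b * -[1+ 0 ]) + a
  sum-−ω = solve-∀
  sum-−1−ω : ∀ a b → + 0 + + 0 + b ≡ (a * -[1+ 0 ] + b * -[1+ 0 ] - b * -[1+ 0 ]) + b + a
  sum-−1−ω = solve-∀
  by-cases : ∀ {c d} → Trit c → Trit d → N (mkE c d) ≡ + 1 → InSector (mkE a b *ᴱ mkE c d) → mkE c d ≡ 1ᴱ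
  by-cases 1ₜ  0ₜ  _  _        = refl
  by-cases 0ₜ  0ₜ  () _
  by-cases 1ₜ  -1ₜ () _
  by-cases -1ₜ 1ₜ  () _
  by-cases -1ₜ 0ₜ  _  (lt , _) = ⊥-elim (ℤP.<-irrefl (sum-−1 a b) (ℤP.+-mono-< b<a lt))
  by-cases 0ₜ  1ₜ  _  (lt , _) = ⊥-elim (ℤP.<-irrefl (sum-ω a b) (ℤP.+-mono-<-≤ (ℤP.+-mono-< lt b<a) 0≤b))
  by-cases 1ₜ  1ₜ  _  (lt , _) = ⊥-elim (ℤP.<-irrefl (sum-1+ω a b) (ℤP.+-mono-<-≤ lt 0≤b))
  by-cases 0ₜ  -1ₜ _  (_ , le) = ⊥-elim (ℤP.<-irrefl (sum-−ω a b) (ℤP.+-mono-≤-< le b<a))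
  by-cases -1ₜ -1ₜ _  (_ , le) = ⊥-elim (ℤP.<-irrefl (sum-−1−ω a b) (ℤP.+-mono-≤-< (ℤP.+-mono-≤ le 0≤b) b<a))

PositivePrime-∣⇒≡ : ∀ {ψ π} → PositivePrime ψ → PositivePrime π → ψ ∣ᴱ π → ψ ≡ π
PositivePrime-∣⇒≡ {ψ} {π} ((_ , ψ-nonunit , _) , ψ∈S) ((π≢0 , _ , π-euclid) , π∈S) (c , π≡ψc)
  with π-euclid ψ c (subst (π ∣ᴱ_) π≡ψc ∣ᴱ-refl)
... | inj₂ (d , c≡πd) = contradiction (d , x*y≡x⇒y≡1 π≢0 π[ψd]≡π) ψ-nonunit
  where
  π[ψd]≡π : π *ᴱ (ψ *ᴱ d) ≡ π
  π[ψd]≡π = trans (x∙yz≈y∙xz π ψ d) (sym (trans π≡ψc (cong (ψ *ᴱ_) c≡πd)))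
... | inj₁ (d , ψ≡πd) = trans ψ≡πd (trans (cong (π *ᴱ_) d≡1) (*ᴱ-identityʳ π))
  where
  d-unit : IsUnit d
  d-unit = c , x*y≡x⇒y≡1 π≢0 (trans (sym (*ᴱ-assoc π d c)) (sym (trans π≡ψc (cong (_*ᴱ c) ψ≡πd))))
  d≡1 : d ≡ 1ᴱ
  d≡1 = InSector-associate⇒≡ {π} {d} π∈S (IsUnit⇒N≡1 {d} d-unit) (subst InSector ψ≡πd ψ∈S)

-- The residue field 𝔽₃

data 𝔽₃ : Set where
  0₃ 1₃ 2₃ : 𝔽₃

toℤ : 𝔽₃ → ℤ
toℤ 0₃ = + 0
toℤ 1₃ = + 1
toℤ 2₃ = + 2

fromℕ₃ : ℕ → 𝔽₃
fromℕ₃ 0                   = 0₃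
fromℕ₃ 1                   = 1₃
fromℕ₃ 2                   = 2₃
fromℕ₃ (suc (suc (suc n))) = fromℕ₃ n

-- −m ≡ 2m (mod 3)
fromℤ₃ : ℤ → 𝔽₃
fromℤ₃ (+ n)    = fromℕ₃ n
fromℤ₃ -[1+ n ] = fromℕ₃ (2 ℕ.* suc n)

3∣n-fromℕ₃n : ∀ n → + 3 ∣ + n - toℤ (fromℕ₃ n)
3∣n-fromℕ₃n 0                   = divides (+ 0) refl
3∣n-fromℕ₃n 1                   = divides (+ 0) refl
3∣n-fromℕ₃n 2                   = divides (+ 0) refl
3∣n-fromℕ₃n (suc (suc (suc n))) =
  subst (+ 3 ∣_) (shift (+ n) (toℤ (fromℕ₃ n))) (∣m∣n⇒∣m+n (3∣n-fromℕ₃n n) ∣-refl)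
  where
  shift : ∀ m t → (m - t) + + 3 ≡ (+ 3 + m) - t
  shift m t = solve (m ∷ t ∷ [])

3∣i-fromℤ₃i : ∀ i → + 3 ∣ i - toℤ (fromℤ₃ i)
3∣i-fromℤ₃i (+ n)    = 3∣n-fromℕ₃n n
3∣i-fromℤ₃i -[1+ n ] = subst (+ 3 ∣_) (shift (+ suc n) t) (∣m∣n⇒∣m-n 3∣2m-t (∣n⇒∣m*n (+ suc n) ∣-refl))
  where
  t : ℤ
  t = toℤ (fromℕ₃ (2 ℕ.* suc n))
  3∣2m-t : + 3 ∣ + 2 * + suc n - t
  3∣2m-t = subst (λ m → + 3 ∣ m - t) (ℤP.pos-* 2 (suc n)) (3∣n-fromℕ₃n (2 ℕ.* suc n))
  shift : ∀ m t → (+ 2 * m - t) - m * + 3 ≡ - m - t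
  shift m t = solve (m ∷ t ∷ [])

3∤ : ∀ i → {False (+ 3 ∣? i)} → ¬ (+ 3 ∣ i)
3∤ i {3∤i} = toWitnessFalse 3∤i

toℤ-injective-mod3 : ∀ a b → + 3 ∣ toℤ a - toℤ b → a ≡ b
toℤ-injective-mod3 0₃ 0₃ _  = refl
toℤ-injective-mod3 1₃ 1₃ _  = refl
toℤ-injective-mod3 2₃ 2₃ _  = refl
toℤ-injective-mod3 0₃ 1₃ 3∣ = ⊥-elim (3∤ _ 3∣)
toℤ-injective-mod3 0₃ 2₃ 3∣ = ⊥-elim (3∤ _ 3∣)
toℤ-injective-mod3 1₃ 0₃ 3∣ = ⊥-elim (3∤ _ 3∣)
toℤ-injective-mod3 1₃ 2₃ 3∣ = ⊥-elim (3∤ _ 3∣)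
toℤ-injective-mod3 2₃ 0₃ 3∣ = ⊥-elim (3∤ _ 3∣)
toℤ-injective-mod3 2₃ 1₃ 3∣ = ⊥-elim (3∤ _ 3∣)

fromℤ₃≡⇔3∣- : ∀ i j → fromℤ₃ i ≡ fromℤ₃ j ⇔ + 3 ∣ i - j
fromℤ₃≡⇔3∣- i j = mk⇔ ⇒ ⇐
  where
  ⇒ : fromℤ₃ i ≡ fromℤ₃ j → + 3 ∣ i - j
  ⇒ ri≡rj = subst (+ 3 ∣_) (difference i j (toℤ (fromℤ₃ j)))
    (∣m∣n⇒∣m-n (subst (λ t → + 3 ∣ i - t) (cong toℤ ri≡rj) (3∣i-fromℤ₃i i)) (3∣i-fromℤ₃i j))
    where
    difference : ∀ i j t → (i - t) - (j - t) ≡ i - j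
    difference i j t = solve (i ∷ j ∷ t ∷ [])
  ⇐ : + 3 ∣ i - j → fromℤ₃ i ≡ fromℤ₃ j
  ⇐ 3∣i-j = toℤ-injective-mod3 _ _ (subst (+ 3 ∣_) (difference i j (toℤ (fromℤ₃ i)) (toℤ (fromℤ₃ j)))
    (∣m∣n⇒∣m+n (∣m∣n⇒∣m-n 3∣i-j (3∣i-fromℤ₃i i)) (3∣i-fromℤ₃i j)))
    where
    difference : ∀ i j s t → ((i - j) - (i - s)) + (j - t) ≡ s - t
    difference i j s t = solve (i ∷ j ∷ s ∷ t ∷ [])

fromℤ₃≡0⇔3∣ : ∀ i → fromℤ₃ i ≡ 0₃ ⇔ + 3 ∣ i
fromℤ₃≡0⇔3∣ i = subst (λ t → fromℤ₃ i ≡ 0₃ ⇔ + 3 ∣ t) (ℤP.+-identityʳ i) (fromℤ₃≡⇔3∣- i (+ 0))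

fromℤ₃[i-3j] : ∀ i j → fromℤ₃ (i - + 3 * j) ≡ fromℤ₃ i
fromℤ₃[i-3j] i j = from (fromℤ₃≡⇔3∣- (i - + 3 * j) i) (divides (- j) (shift i j))
  where
  shift : ∀ i j → (i - + 3 * j) - i ≡ - j * + 3
  shift i j = solve (i ∷ j ∷ [])

infixl 6 _+₃_
infixl 7 _*₃_
infixr 8 _^₃_

_+₃_ : 𝔽₃ → 𝔽₃ → 𝔽₃
a +₃ b = fromℤ₃ (toℤ a + toℤ b)

_*₃_ : 𝔽₃ → 𝔽₃ → 𝔽₃
a *₃ b = fromℤ₃ (toℤ a * toℤ b)

_^₃_ : 𝔽₃ → ℕ → 𝔽₃
a ^₃ zero  = 1₃
a ^₃ suc n = a *₃ a ^₃ n

fromℤ₃-+ : ∀ i j → fromℤ₃ (i + j) ≡ fromℤ₃ i +₃ fromℤ₃ j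
fromℤ₃-+ i j = from (fromℤ₃≡⇔3∣- (i + j) (s + t)) (subst (+ 3 ∣_) (difference i j s t)
  (∣m∣n⇒∣m+n (3∣i-fromℤ₃i i) (3∣i-fromℤ₃i j)))
  where
  s t : ℤ
  s = toℤ (fromℤ₃ i)
  t = toℤ (fromℤ₃ j)
  difference : ∀ i j s t → (i - s) + (j - t) ≡ (i + j) - (s + t)
  difference i j s t = solve (i ∷ j ∷ s ∷ t ∷ [])

fromℤ₃-* : ∀ i j → fromℤ₃ (i * j) ≡ fromℤ₃ i *₃ fromℤ₃ j
fromℤ₃-* i j = from (fromℤ₃≡⇔3∣- (i * j) (s * t)) (subst (+ 3 ∣_) (difference i j s t)
  (∣m∣n⇒∣m+n (∣m⇒∣m*n j (3∣i-fromℤ₃i i)) (∣n⇒∣m*n s (3∣i-fromℤ₃i j))))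
  where
  s t : ℤ
  s = toℤ (fromℤ₃ i)
  t = toℤ (fromℤ₃ j)
  difference : ∀ i j s t → (i - s) * j + s * (j - t) ≡ i * j - s * t
  difference i j s t = solve (i ∷ j ∷ s ∷ t ∷ [])

_≟₃_ : DecidableEquality 𝔽₃
a ≟₃ b = map′ (toℤ-injective-mod3 a b ∘ 3∣0) (cong toℤ) (toℤ a ℤ.≟ toℤ b)
  where
  3∣0 : toℤ a ≡ toℤ b → + 3 ∣ toℤ a - toℤ b
  3∣0 eq = divides (+ 0) (trans (cong (_- toℤ b) eq) (ℤP.+-inverseʳ (toℤ b)))

≢0₃ : ∀ {a} → a ≢ 0₃ → a ≡ 1₃ ⊎ a ≡ 2₃
≢0₃ {0₃} a≢0 = contradiction refl a≢0
≢0₃ {1₃} _   = inj₁ refl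
≢0₃ {2₃} _   = inj₂ refl

*₃-zero-divisor : ∀ a b → a *₃ b ≡ 0₃ → a ≡ 0₃ ⊎ b ≡ 0₃
*₃-zero-divisor 0₃ _  _  = inj₁ refl
*₃-zero-divisor 1₃ 0₃ _  = inj₂ refl
*₃-zero-divisor 2₃ 0₃ _  = inj₂ refl
*₃-zero-divisor 1₃ 1₃ ()
*₃-zero-divisor 1₃ 2₃ ()
*₃-zero-divisor 2₃ 1₃ ()
*₃-zero-divisor 2₃ 2₃ ()

-- Reduction modulo λ₃

tr : 𝔼 → ℤ
tr x = re x + im x

residue : 𝔼 → 𝔽₃
residue x = fromℤ₃ (tr x)

tr-+ : ∀ x y → tr (x +ᴱ y) ≡ tr x + tr y
tr-+ (mkE a b) (mkE c d) = additive a b c d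
  where
  additive : ∀ a b c d → (a + c) + (b + d) ≡ (a + b) + (c + d)
  additive = solve-∀

tr--ᴱ : ∀ x y → tr (x -ᴱ y) ≡ tr x - tr y
tr--ᴱ (mkE a b) (mkE c d) = additive a b c d
  where
  additive : ∀ a b c d → (a + - c) + (b + - d) ≡ (a + b) - (c + d)
  additive = solve-∀

tr-* : ∀ x y → tr (x *ᴱ y) ≡ tr x * tr y - + 3 * (im x * im y)
tr-* (mkE a b) (mkE c d) = multiplicative a b c d
  where
  multiplicative : ∀ a b c d → (a * c - b * d) + (a * d + b * c - b * d) ≡ (a + b) * (c + d) - + 3 * (b * d)
  multiplicative = solve-∀

N≡tr²-3re·im : ∀ x → N x ≡ tr x * tr x - + 3 * (re x * im x)
N≡tr²-3re·im (mkE a b) = quadratic a b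
  where
  quadratic : ∀ a b → a * a - a * b + b * b ≡ (a + b) * (a + b) - + 3 * (a * b)
  quadratic = solve-∀

tr[λ₃*x] : ∀ x → tr (λ₃ *ᴱ x) ≡ re x * + 3
tr[λ₃*x] (mkE a b) = linear a b
  where
  linear : ∀ a b → (+ 2 * a - + 1 * b) + (+ 2 * b + + 1 * a - + 1 * b) ≡ a * + 3
  linear = solve-∀

λ₃-quotient : ∀ a b q → a + b ≡ q * + 3 → mkE a b ≡ λ₃ *ᴱ mkE q (b - q)
λ₃-quotient a b q a+b≡3q = cong₂ mkE (trans (trans (real a b) (cong (_- b) a+b≡3q)) (real′ b q)) (imag b q)
  where
  real : ∀ a b → a ≡ (a + b) - b
  real = solve-∀
  real′ : ∀ b q → q * + 3 - b ≡ + 2 * q - + 1 * (b - q)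
  real′ = solve-∀
  imag : ∀ b q → b ≡ + 2 * (b - q) + + 1 * q - + 1 * (b - q)
  imag = solve-∀

λ₃∣⇔3∣tr : ∀ x → λ₃ ∣ᴱ x ⇔ + 3 ∣ tr x
λ₃∣⇔3∣tr x = mk⇔ (λ { (c , refl) → divides (re c) (tr[λ₃*x] c) })
                 (λ { (divides q a+b≡3q) → mkE q (im x - q) , λ₃-quotient (re x) (im x) q a+b≡3q })

residue≡0⇔λ₃∣ : ∀ x → residue x ≡ 0₃ ⇔ λ₃ ∣ᴱ x
residue≡0⇔λ₃∣ x = ⇔-sym (λ₃∣⇔3∣tr x) ⇔-∘ fromℤ₃≡0⇔3∣ (tr x)

≡mod-λ₃⇔residue≡ : ∀ x y → x ≡ y mod-λ₃ ⇔ residue x ≡ residue y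
≡mod-λ₃⇔residue≡ x y =
  ⇔-sym (fromℤ₃≡⇔3∣- (tr x) (tr y)) ⇔-∘ subst (λ t → x ≡ y mod-λ₃ ⇔ + 3 ∣ t) (tr--ᴱ x y) (λ₃∣⇔3∣tr (x -ᴱ y))

residue-+ : ∀ x y → residue (x +ᴱ y) ≡ residue x +₃ residue y
residue-+ x y = trans (cong fromℤ₃ (tr-+ x y)) (fromℤ₃-+ (tr x) (tr y))

residue-* : ∀ x y → residue (x *ᴱ y) ≡ residue x *₃ residue y
residue-* x y = begin
  fromℤ₃ (tr (x *ᴱ y))                               ≡⟨ cong fromℤ₃ (tr-* x y) ⟩
  fromℤ₃ (tr x * tr y - + 3 * (im x * im y))         ≡⟨ fromℤ₃[i-3j] (tr x * tr y) (im x * im y) ⟩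
  fromℤ₃ (tr x * tr y)                               ≡⟨ fromℤ₃-* (tr x) (tr y) ⟩
  residue x *₃ residue y                             ∎
  where open ≡-Reasoning

fromℤ₃[N] : ∀ x → fromℤ₃ (N x) ≡ residue x *₃ residue x
fromℤ₃[N] x = begin
  fromℤ₃ (N x)                                       ≡⟨ cong fromℤ₃ (N≡tr²-3re·im x) ⟩
  fromℤ₃ (tr x * tr x - + 3 * (re x * im x))         ≡⟨ fromℤ₃[i-3j] (tr x * tr x) (re x * im x) ⟩
  fromℤ₃ (tr x * tr x)                               ≡⟨ fromℤ₃-* (tr x) (tr x) ⟩
  residue x *₃ residue x                             ∎
  where open ≡-Reasoning

λ₃-prime : IsPrime λ₃
λ₃-prime = (λ ()) , λ₃-nonunit , euclid
  where
  λ₃-nonunit : ¬ IsUnit λ₃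
  λ₃-nonunit λ₃-unit = case IsUnit⇒N≡1 {λ₃} λ₃-unit of λ ()
  euclid : ∀ x y → λ₃ ∣ᴱ (x *ᴱ y) → λ₃ ∣ᴱ x ⊎ λ₃ ∣ᴱ y
  euclid x y λ₃∣xy = Sum.map (to (residue≡0⇔λ₃∣ x)) (to (residue≡0⇔λ₃∣ y))
    (*₃-zero-divisor (residue x) (residue y) (trans (sym (residue-* x y)) (from (residue≡0⇔λ₃∣ (x *ᴱ y)) λ₃∣xy)))

3∣N⇒λ₃∣ : ∀ x → + 3 ∣ N x → λ₃ ∣ᴱ x
3∣N⇒λ₃∣ x 3∣Nx = to (residue≡0⇔λ₃∣ x) (Sum.[ id , id ]′ (*₃-zero-divisor (residue x) (residue x) r²≡0))
  where
  r²≡0 : residue x *₃ residue x ≡ 0₃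
  r²≡0 = trans (sym (fromℤ₃[N] x)) (from (fromℤ₃≡0⇔3∣ (N x)) 3∣Nx)

N≡3N⇒λ₃∥ : ∀ {s a} → Odd a → N s ≡ + 3 * N a → λ₃ ∣ᴱ s × ¬ (λ₃ *ᴱ λ₃) ∣ᴱ s
N≡3N⇒λ₃∥ {s} {a} odd Ns≡3Na = 3∣N⇒λ₃∣ s (divides (N a) (trans Ns≡3Na (ℤP.*-comm (+ 3) (N a)))) , λ₃²∤s
  where
  λ₃²∤s : ¬ (λ₃ *ᴱ λ₃) ∣ᴱ s
  λ₃²∤s (d , refl) = odd (3∣N⇒λ₃∣ a (divides (N d) (ℤP.*-cancelˡ-≡ (+ 3) (N a) (N d * + 3) 3Na≡9Nd)))
    where
    open ≡-Reasoning
    9x≡3[x3] : ∀ x → + 9 * x ≡ + 3 * (x * + 3)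
    9x≡3[x3] = solve-∀
    3Na≡9Nd : + 3 * N a ≡ + 3 * (N d * + 3)
    3Na≡9Nd = begin
      + 3 * N a                 ≡⟨ Ns≡3Na ⟨
      N ((λ₃ *ᴱ λ₃) *ᴱ d)       ≡⟨ N-* (λ₃ *ᴱ λ₃) d ⟩
      N (λ₃ *ᴱ λ₃) * N d        ≡⟨ cong (_* N d) (N-* λ₃ λ₃) ⟩
      + 9 * N d                 ≡⟨ 9x≡3[x3] (N d) ⟩
      + 3 * (N d * + 3)         ∎

geomSum₃ : 𝔽₃ → ℕ → 𝔽₃
geomSum₃ a zero    = 1₃
geomSum₃ a (suc e) = geomSum₃ a e +₃ a ^₃ suc e

residue-^ : ∀ x n → residue (x ^ᴱ n) ≡ residue x ^₃ n
residue-^ x zero    = refl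
residue-^ x (suc n) = trans (residue-* x (x ^ᴱ n)) (cong (residue x *₃_) (residue-^ x n))

residue-geomSum : ∀ x e → residue (geomSum x e) ≡ geomSum₃ (residue x) e
residue-geomSum x zero    = refl
residue-geomSum x (suc e) =
  trans (residue-+ (geomSum x e) (x ^ᴱ suc e)) (cong₂ _+₃_ (residue-geomSum x e) (residue-^ x (suc e)))

geomSum₃-1₃-period : ∀ e → geomSum₃ 1₃ (3 ℕ.+ e) ≡ geomSum₃ 1₃ e
geomSum₃-1₃-period e = s+x+x+x≡s (geomSum₃ 1₃ e) (1₃ ^₃ suc e)
  where
  s+x+x+x≡s : ∀ s x → s +₃ x +₃ 1₃ *₃ x +₃ 1₃ *₃ (1₃ *₃ x) ≡ s
  s+x+x+x≡s 0₃ 0₃ = refl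
  s+x+x+x≡s 0₃ 1₃ = refl
  s+x+x+x≡s 0₃ 2₃ = refl
  s+x+x+x≡s 1₃ 0₃ = refl
  s+x+x+x≡s 1₃ 1₃ = refl
  s+x+x+x≡s 1₃ 2₃ = refl
  s+x+x+x≡s 2₃ 0₃ = refl
  s+x+x+x≡s 2₃ 1₃ = refl
  s+x+x+x≡s 2₃ 2₃ = refl

geomSum₃-2₃-period : ∀ e → geomSum₃ 2₃ (2 ℕ.+ e) ≡ geomSum₃ 2₃ e
geomSum₃-2₃-period e = s+x+2x≡s (geomSum₃ 2₃ e) (2₃ ^₃ suc e)
  where
  s+x+2x≡s : ∀ s x → s +₃ x +₃ 2₃ *₃ x ≡ s
  s+x+2x≡s 0₃ 0₃ = refl
  s+x+2x≡s 0₃ 1₃ = refl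
  s+x+2x≡s 0₃ 2₃ = refl
  s+x+2x≡s 1₃ 0₃ = refl
  s+x+2x≡s 1₃ 1₃ = refl
  s+x+2x≡s 1₃ 2₃ = refl
  s+x+2x≡s 2₃ 0₃ = refl
  s+x+2x≡s 2₃ 1₃ = refl
  s+x+2x≡s 2₃ 2₃ = refl

geomSum₃-1₃≡0⇔ : ∀ e → geomSum₃ 1₃ e ≡ 0₃ ⇔ e % 3 ≡ 2
geomSum₃-1₃≡0⇔ 0                   = mk⇔ (λ ()) (λ ())
geomSum₃-1₃≡0⇔ 1                   = mk⇔ (λ ()) (λ ())
geomSum₃-1₃≡0⇔ 2                   = mk⇔ (λ _ → refl) (λ _ → refl)
geomSum₃-1₃≡0⇔ (suc (suc (suc e))) =
  subst (λ s → s ≡ 0₃ ⇔ e % 3 ≡ 2) (sym (geomSum₃-1₃-period e)) (geomSum₃-1₃≡0⇔ e)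

geomSum₃-2₃≡0⇔ : ∀ e → geomSum₃ 2₃ e ≡ 0₃ ⇔ e % 2 ≡ 1
geomSum₃-2₃≡0⇔ 0             = mk⇔ (λ ()) (λ ())
geomSum₃-2₃≡0⇔ 1             = mk⇔ (λ _ → refl) (λ _ → refl)
geomSum₃-2₃≡0⇔ (suc (suc e)) =
  subst (λ s → s ≡ 0₃ ⇔ e % 2 ≡ 1) (sym (geomSum₃-2₃-period e)) (geomSum₃-2₃≡0⇔ e)

m%2≢1⇒m%2≡0 : ∀ m → m % 2 ≢ 1 → m % 2 ≡ 0
m%2≢1⇒m%2≡0 0             _     = refl
m%2≢1⇒m%2≡0 1             m%2≢1 = contradiction refl m%2≢1
m%2≢1⇒m%2≡0 (suc (suc m)) m%2≢1 = m%2≢1⇒m%2≡0 m m%2≢1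

λ₃∣geomSum⇔ : ∀ ψ e → λ₃ ∣ᴱ geomSum ψ e ⇔ geomSum₃ (residue ψ) e ≡ 0₃
λ₃∣geomSum⇔ ψ e = mk⇔ (trans (sym (residue-geomSum ψ e)) ∘ from (residue≡0⇔λ₃∣ (geomSum ψ e)))
                      (to (residue≡0⇔λ₃∣ (geomSum ψ e)) ∘ trans (residue-geomSum ψ e))

λ₃∣geomSum⇔[1₃] : ∀ {ψ} e → residue ψ ≡ 1₃ → λ₃ ∣ᴱ geomSum ψ e ⇔ e % 3 ≡ 2
λ₃∣geomSum⇔[1₃] {ψ} e rψ≡1 =
  geomSum₃-1₃≡0⇔ e ⇔-∘ subst (λ c → λ₃ ∣ᴱ geomSum ψ e ⇔ geomSum₃ c e ≡ 0₃) rψ≡1 (λ₃∣geomSum⇔ ψ e)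

λ₃∣geomSum⇔[2₃] : ∀ {ψ} e → residue ψ ≡ 2₃ → λ₃ ∣ᴱ geomSum ψ e ⇔ e % 2 ≡ 1
λ₃∣geomSum⇔[2₃] {ψ} e rψ≡2 =
  geomSum₃-2₃≡0⇔ e ⇔-∘ subst (λ c → λ₃ ∣ᴱ geomSum ψ e ⇔ geomSum₃ c e ≡ 0₃) rψ≡2 (λ₃∣geomSum⇔ ψ e)

-- Products over lists and prime factorizations

_≟ᴱ_ : DecidableEquality 𝔼
mkE a b ≟ᴱ mkE c d = map′ (uncurry (cong₂ mkE)) (λ eq → cong re eq , cong im eq) (a ℤ.≟ c ×-dec b ℤ.≟ d)

∏ : ∀ {A : Set} → (A → 𝔼) → List A → 𝔼
∏ f []       = 1ᴱ
∏ f (x ∷ xs) = f x *ᴱ ∏ f xs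

∏-cong : ∀ {A : Set} {f g : A → 𝔼} xs → (∀ {x} → x ∈ xs → f x ≡ g x) → ∏ f xs ≡ ∏ g xs
∏-cong []       _   = refl
∏-cong (x ∷ xs) f≡g = cong₂ _*ᴱ_ (f≡g (here refl)) (∏-cong xs (f≡g ∘ there))

∏-map : ∀ {A B : Set} (f : B → 𝔼) (g : A → B) xs → ∏ f (map g xs) ≡ ∏ (f ∘ g) xs
∏-map f g []       = refl
∏-map f g (x ∷ xs) = cong (f (g x) *ᴱ_) (∏-map f g xs)

∏-filter : ∀ {A : Set} {P : Pred A 0ℓ} (P? : Decidable P) (f : A → 𝔼) xs →
           ∏ f xs ≡ ∏ f (filter P? xs) *ᴱ ∏ f (filter (¬? ∘ P?) xs)
∏-filter P? f []       = refl
∏-filter P? f (x ∷ xs) with P? x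
... | yes _ = trans (cong (f x *ᴱ_) (∏-filter P? f xs)) (sym (*ᴱ-assoc (f x) (∏ f (filter P? xs)) _))
... | no  _ = trans (cong (f x *ᴱ_) (∏-filter P? f xs)) (x∙yz≈y∙xz (f x) (∏ f (filter P? xs)) _)

∣∏ : ∀ {A : Set} (f : A → 𝔼) {x xs} → x ∈ xs → f x ∣ᴱ ∏ f xs
∣∏ f {xs = _ ∷ xs} (here refl)   = ∏ f xs , refl
∣∏ f {x} {y ∷ _}   (there x∈xs) = ∣n⇒∣m*ᴱn {f x} (f y) (∣∏ f x∈xs)

prime∣∏⇒∣ : ∀ {A : Set} {p} (f : A → 𝔼) xs → IsPrime p → p ∣ᴱ ∏ f xs → ∃ λ x → x ∈ xs × p ∣ᴱ f x
prime∣∏⇒∣ {p = p} f [] (_ , p-nonunit , _) p∣1 = contradiction (∣unit⇒unit {p} {1ᴱ} p∣1 (1ᴱ , refl)) p-nonunit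
prime∣∏⇒∣ f (x ∷ xs) p-prime@(_ , _ , p-euclid) p∣∏ with p-euclid (f x) (∏ f xs) p∣∏
... | inj₁ p∣fx = x , here refl , p∣fx
... | inj₂ p∣∏xs with prime∣∏⇒∣ f xs p-prime p∣∏xs
...   | y , y∈xs , p∣fy = y , there y∈xs , p∣fy

prime∥∏⇒unique-factor : ∀ {A : Set} {p} (f : A → 𝔼) xs → IsPrime p → p ∣ᴱ ∏ f xs → ¬ (p *ᴱ p) ∣ᴱ ∏ f xs →
  ∃ λ x → x ∈ xs × p ∣ᴱ f x × (∀ {y} → y ∈ xs → y ≢ x → ¬ p ∣ᴱ f y)
prime∥∏⇒unique-factor {p = p} f [] (_ , p-nonunit , _) p∣1 _ =
  contradiction (∣unit⇒unit {p} {1ᴱ} p∣1 (1ᴱ , refl)) p-nonunit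
prime∥∏⇒unique-factor {p = p} f (x ∷ xs) p-prime@(_ , _ , p-euclid) p∣∏ p²∤∏
  with p-euclid (f x) (∏ f xs) p∣∏
... | inj₁ p∣fx = x , here refl , p∣fx , others
  where
  others : ∀ {y} → y ∈ x ∷ xs → y ≢ x → ¬ p ∣ᴱ f y
  others (here refl)  y≢x = contradiction refl y≢x
  others (there y∈xs) _   = λ p∣fy → p²∤∏ (*ᴱ-mono-∣ᴱ {p} {p} p∣fx (∣ᴱ-trans {p} p∣fy (∣∏ f y∈xs)))
... | inj₂ p∣∏xs with prime∥∏⇒unique-factor f xs p-prime p∣∏xs (p²∤∏ ∘ ∣n⇒∣m*ᴱn {p *ᴱ p} (f x))
...   | z , z∈xs , p∣fz , others = z , there z∈xs , p∣fz , others′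
  where
  others′ : ∀ {y} → y ∈ x ∷ xs → y ≢ z → ¬ p ∣ᴱ f y
  others′ (here refl)  _ = λ p∣fx → p²∤∏ (*ᴱ-mono-∣ᴱ {p} {p} p∣fx p∣∏xs)
  others′ (there y∈xs)   = others y∈xs

filter-≟-Unique : ∀ {x xs} → Unique xs → x ∈ xs → filter (_≟ᴱ x) xs ≡ x ∷ []
filter-≟-Unique {x} {_ ∷ xs} distinct (here refl) =
  trans (filter-accept (_≟ᴱ x) refl)
        (cong (x ∷_) (filter-none (_≟ᴱ x) (All.map (λ x≢y y≡x → x≢y (sym y≡x)) (AllPairs.head distinct))))
filter-≟-Unique {x} {y ∷ xs} distinct (there x∈xs) =
  trans (filter-reject (_≟ᴱ x) (All.lookup (AllPairs.head distinct) x∈xs)) (filter-≟-Unique (AllPairs.tail distinct) x∈xs)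

prodPow≡∏ : ∀ l → prodPow l ≡ ∏ (uncurry _^ᴱ_) l
prodPow≡∏ []      = refl
prodPow≡∏ (p ∷ l) = cong (uncurry _^ᴱ_ p *ᴱ_) (prodPow≡∏ l)

σ-list≡∏ : ∀ l → σ-list l ≡ ∏ (uncurry geomSum) l
σ-list≡∏ []      = refl
σ-list≡∏ (p ∷ l) = cong (uncurry geomSum p *ᴱ_) (σ-list≡∏ l)

prodExp≡∏ : ∀ L e → prodExp L e ≡ ∏ (λ ψ → ψ ^ᴱ e ψ) L
prodExp≡∏ []      e = refl
prodExp≡∏ (ψ ∷ L) e = cong (ψ ^ᴱ e ψ *ᴱ_) (prodExp≡∏ L e)

-- 0 off the support of the list
exponentOf : List (𝔼 × ℕ) → 𝔼 → ℕ
exponentOf []            ψ = 0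
exponentOf ((π , n) ∷ l) ψ with ψ ≟ᴱ π
... | yes _ = n
... | no  _ = exponentOf l ψ

exponentOf-∈ : ∀ {l ψ n} → Unique (map proj₁ l) → (ψ , n) ∈ l → exponentOf l ψ ≡ n
exponentOf-∈ {_ ∷ l} {ψ} _ (here refl) with ψ ≟ᴱ ψ
... | yes _   = refl
... | no ψ≢ψ = contradiction refl ψ≢ψ
exponentOf-∈ {(π , _) ∷ l} {ψ} distinct (there ψn∈l) with ψ ≟ᴱ π
... | yes refl = contradiction (∈-map⁺ proj₁ ψn∈l) (Unique.Unique[x∷xs]⇒x∉xs distinct)
... | no  _    = exponentOf-∈ (AllPairs.tail distinct) ψn∈l

∏-pairs : ∀ (f : 𝔼 → ℕ → 𝔼) l → Unique (map proj₁ l) →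
          ∏ (uncurry f) l ≡ ∏ (λ ψ → f ψ (exponentOf l ψ)) (map proj₁ l)
∏-pairs f l distinct = trans
  (∏-cong l (λ { {ψ , n} ψn∈l → cong (f ψ) (sym (exponentOf-∈ distinct ψn∈l)) }))
  (sym (∏-map (λ ψ → f ψ (exponentOf l ψ)) proj₁ l))

module PrimeFactorization {α : 𝔼} (F : Factorization α) where
  open Factorization F

  primes : List 𝔼
  primes = map proj₁ factors

  exponent : 𝔼 → ℕ
  exponent = exponentOf factors

  α≡unit*∏ : α ≡ unit *ᴱ ∏ (λ ψ → ψ ^ᴱ exponent ψ) primes
  α≡unit*∏ = trans factors-eq (cong (unit *ᴱ_) (trans (prodPow≡∏ factors) (∏-pairs _^ᴱ_ factors distinct)))

  σ≡∏ : σ F ≡ ∏ (λ ψ → geomSum ψ (exponent ψ)) primes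
  σ≡∏ = trans (σ-list≡∏ factors) (∏-pairs geomSum factors distinct)

  ∈primes⇔PositivePrime∣ : ∀ ψ → ψ ∈ primes ⇔ (PositivePrime ψ × ψ ∣ᴱ α)
  ∈primes⇔PositivePrime∣ ψ = mk⇔ ⇒ ⇐
    where
    ⇒ : ψ ∈ primes → PositivePrime ψ × ψ ∣ᴱ α
    ⇒ ψ∈primes with ∈-map⁻ proj₁ ψ∈primes
    ... | (.ψ , n) , ψn∈factors , refl with All.lookup factors-ok ψn∈factors
    ...   | ψ-pp , 1≤n = ψ-pp , subst (ψ ∣ᴱ_) (sym factors-eq) (∣n⇒∣m*ᴱn {ψ} unit ψ∣∏)
      where
      ψ∣∏ : ψ ∣ᴱ prodPow factors
      ψ∣∏ = ∣ᴱ-trans {ψ} (x∣x^n ψ 1≤n)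
              (subst ((ψ ^ᴱ n) ∣ᴱ_) (sym (prodPow≡∏ factors)) (∣∏ (uncurry _^ᴱ_) ψn∈factors))
    ⇐ : PositivePrime ψ × ψ ∣ᴱ α → ψ ∈ primes
    ⇐ (ψ-pp@(ψ-prime@(_ , ψ-nonunit , ψ-euclid) , _) , ψ∣α)
      with ψ-euclid unit (prodPow factors) (subst (ψ ∣ᴱ_) factors-eq ψ∣α)
    ... | inj₁ ψ∣unit = contradiction (∣unit⇒unit {ψ} ψ∣unit unit-unit) ψ-nonunit
    ... | inj₂ ψ∣∏ with prime∣∏⇒∣ (uncurry _^ᴱ_) factors ψ-prime (subst (ψ ∣ᴱ_) (prodPow≡∏ factors) ψ∣∏)
    ...   | (π , n) , πn∈factors , ψ∣πⁿ = subst (_∈ primes) (sym ψ≡π) (∈-map⁺ proj₁ πn∈factors)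
      where
      ψ≡π : ψ ≡ π
      ψ≡π = PositivePrime-∣⇒≡ ψ-pp (proj₁ (All.lookup factors-ok πn∈factors)) (prime∣x^n⇒∣x n ψ-prime ψ∣πⁿ)

-- Odd norm-perfect Eisenstein integers

module OddNormPerfect {α : 𝔼} (odd : Odd α) (F : Factorization α) (perfect : N (σ F) ≡ + 3 * N α) where
  open Factorization F using (unit; distinct)
  open PrimeFactorization F

  private
    λ₃∥σ : λ₃ ∣ᴱ σ F × ¬ (λ₃ *ᴱ λ₃) ∣ᴱ σ F
    λ₃∥σ = N≡3N⇒λ₃∥ {σ F} {α} odd perfect

    special-prime : ∃ λ ψ₀ → ψ₀ ∈ primes × λ₃ ∣ᴱ geomSum ψ₀ (exponent ψ₀)
                           × (∀ {ψ} → ψ ∈ primes → ψ ≢ ψ₀ → ¬ λ₃ ∣ᴱ geomSum ψ (exponent ψ))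
    special-prime = prime∥∏⇒unique-factor (λ ψ → geomSum ψ (exponent ψ)) primes λ₃-prime
      (subst (λ₃ ∣ᴱ_) σ≡∏ (proj₁ λ₃∥σ)) (proj₂ λ₃∥σ ∘ subst ((λ₃ *ᴱ λ₃) ∣ᴱ_) (sym σ≡∏))

  ψ₀ : 𝔼
  ψ₀ = proj₁ special-prime

  ψ₀∈primes : ψ₀ ∈ primes
  ψ₀∈primes = proj₁ (proj₂ special-prime)

  k : ℕ
  k = exponent ψ₀

  λ₃∣σ[ψ₀ᵏ] : λ₃ ∣ᴱ geomSum ψ₀ k
  λ₃∣σ[ψ₀ᵏ] = proj₁ (proj₂ (proj₂ special-prime))

  λ₃∤σ[ψᵉ] : ∀ {ψ} → ψ ∈ primes → ψ ≢ ψ₀ → ¬ λ₃ ∣ᴱ geomSum ψ (exponent ψ)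
  λ₃∤σ[ψᵉ] = proj₂ (proj₂ (proj₂ special-prime))

  residue-of-prime : ∀ {ψ} → ψ ∈ primes → residue ψ ≡ 1₃ ⊎ residue ψ ≡ 2₃
  residue-of-prime {ψ} ψ∈primes = ≢0₃ λ rψ≡0 →
    odd (∣ᴱ-trans {λ₃} (to (residue≡0⇔λ₃∣ ψ) rψ≡0) (proj₂ (to (∈primes⇔PositivePrime∣ ψ) ψ∈primes)))

  InP⇔ : ∀ j ψ → InP j α ψ ⇔ (ψ ∈ primes × residue ψ ≡ residue (fromℕᴱ j))
  InP⇔ j ψ = mk⇔
    (λ (ψ-pp , ψ≡j , ψ∣α) → from (∈primes⇔PositivePrime∣ ψ) (ψ-pp , ψ∣α) , to (≡mod-λ₃⇔residue≡ ψ (fromℕᴱ j)) ψ≡j)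
    (λ (ψ∈primes , rψ≡rj) → let (ψ-pp , ψ∣α) = to (∈primes⇔PositivePrime∣ ψ) ψ∈primes in
                            ψ-pp , from (≡mod-λ₃⇔residue≡ ψ (fromℕᴱ j)) rψ≡rj , ψ∣α)

  others L₁ L₂ : List 𝔼
  others = filter (¬? ∘ (_≟ᴱ ψ₀)) primes
  L₁     = filter ((_≟₃ 1₃) ∘ residue) others
  L₂     = filter (¬? ∘ (_≟₃ 1₃) ∘ residue) others

  ∈L₁⇔ : ∀ ψ → ψ ∈ L₁ ⇔ ((ψ ∈ primes × ψ ≢ ψ₀) × residue ψ ≡ 1₃)
  ∈L₁⇔ ψ = mk⇔ (λ ψ∈L₁ → let (ψ∈others , rψ≡1) = ∈-filter⁻ _ ψ∈L₁ in ∈-filter⁻ _ ψ∈others , rψ≡1)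
               (λ ((ψ∈primes , ψ≢ψ₀) , rψ≡1) → ∈-filter⁺ _ (∈-filter⁺ _ ψ∈primes ψ≢ψ₀) rψ≡1)

  ∈L₂⇔ : ∀ ψ → ψ ∈ L₂ ⇔ ((ψ ∈ primes × ψ ≢ ψ₀) × residue ψ ≡ 2₃)
  ∈L₂⇔ ψ = mk⇔
    (λ ψ∈L₂ → let (ψ∈others , rψ≢1) = ∈-filter⁻ _ ψ∈L₂; (ψ∈primes , ψ≢ψ₀) = ∈-filter⁻ _ ψ∈others in
              (ψ∈primes , ψ≢ψ₀) , Sum.[ flip contradiction rψ≢1 , id ]′ (residue-of-prime ψ∈primes))
    (λ ((ψ∈primes , ψ≢ψ₀) , rψ≡2) → ∈-filter⁺ _ (∈-filter⁺ _ ψ∈primes ψ≢ψ₀) λ rψ≡1 → case trans (sym rψ≡1) rψ≡2 of λ ())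

  ψ₀-class : (InP 1 α ψ₀ × k % 3 ≡ 2) ⊎ (InP 2 α ψ₀ × k % 2 ≡ 1)
  ψ₀-class = Sum.map
    (λ rψ₀≡1 → from (InP⇔ 1 ψ₀) (ψ₀∈primes , rψ₀≡1) , to (λ₃∣geomSum⇔[1₃] k rψ₀≡1) λ₃∣σ[ψ₀ᵏ])
    (λ rψ₀≡2 → from (InP⇔ 2 ψ₀) (ψ₀∈primes , rψ₀≡2) , to (λ₃∣geomSum⇔[2₃] k rψ₀≡2) λ₃∣σ[ψ₀ᵏ])
    (residue-of-prime ψ₀∈primes)

  L₁-enumerates : Enumerates (λ ψ → InP 1 α ψ × ψ ≢ ψ₀) L₁
  L₁-enumerates = Unique.filter⁺ _ (Unique.filter⁺ _ distinct) , λ ψ →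
    (λ ψ∈L₁ → let ((ψ∈primes , ψ≢ψ₀) , rψ≡1) = to (∈L₁⇔ ψ) ψ∈L₁ in from (InP⇔ 1 ψ) (ψ∈primes , rψ≡1) , ψ≢ψ₀) ,
    (λ (ψ∈P₁ , ψ≢ψ₀) → let (ψ∈primes , rψ≡1) = to (InP⇔ 1 ψ) ψ∈P₁ in from (∈L₁⇔ ψ) ((ψ∈primes , ψ≢ψ₀) , rψ≡1))

  L₂-enumerates : Enumerates (λ ψ → InP 2 α ψ × ψ ≢ ψ₀) L₂
  L₂-enumerates = Unique.filter⁺ _ (Unique.filter⁺ _ distinct) , λ ψ →
    (λ ψ∈L₂ → let ((ψ∈primes , ψ≢ψ₀) , rψ≡2) = to (∈L₂⇔ ψ) ψ∈L₂ in from (InP⇔ 2 ψ) (ψ∈primes , rψ≡2) , ψ≢ψ₀) ,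
    (λ (ψ∈P₂ , ψ≢ψ₀) → let (ψ∈primes , rψ≡2) = to (InP⇔ 2 ψ) ψ∈P₂ in from (∈L₂⇔ ψ) ((ψ∈primes , ψ≢ψ₀) , rψ≡2))

  L₁-exponents : ∀ ψ → ψ ∈ L₁ → exponent ψ % 3 ≢ 2
  L₁-exponents ψ ψ∈L₁ = let ((ψ∈primes , ψ≢ψ₀) , rψ≡1) = to (∈L₁⇔ ψ) ψ∈L₁ in
    λ₃∤σ[ψᵉ] ψ∈primes ψ≢ψ₀ ∘ from (λ₃∣geomSum⇔[1₃] (exponent ψ) rψ≡1)

  L₂-exponents : ∀ ψ → ψ ∈ L₂ → exponent ψ % 2 ≡ 0
  L₂-exponents ψ ψ∈L₂ = let ((ψ∈primes , ψ≢ψ₀) , rψ≡2) = to (∈L₂⇔ ψ) ψ∈L₂ in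
    m%2≢1⇒m%2≡0 (exponent ψ) (λ₃∤σ[ψᵉ] ψ∈primes ψ≢ψ₀ ∘ from (λ₃∣geomSum⇔[2₃] (exponent ψ) rψ≡2))

  α-decomposition : α ≡ unit *ᴱ (ψ₀ ^ᴱ k) *ᴱ prodExp L₁ exponent *ᴱ prodExp L₂ exponent
  α-decomposition = begin
    α
      ≡⟨ α≡unit*∏ ⟩
    unit *ᴱ ∏ g primes
      ≡⟨ cong (unit *ᴱ_) (∏-filter (_≟ᴱ ψ₀) g primes) ⟩
    unit *ᴱ (∏ g (filter (_≟ᴱ ψ₀) primes) *ᴱ ∏ g others)
      ≡⟨ cong (λ ps → unit *ᴱ (∏ g ps *ᴱ ∏ g others)) ψ₀-once ⟩
    unit *ᴱ ((ψ₀ ^ᴱ k *ᴱ 1ᴱ) *ᴱ ∏ g others)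
      ≡⟨ cong (λ y → unit *ᴱ (y *ᴱ ∏ g others)) (*ᴱ-identityʳ (ψ₀ ^ᴱ k)) ⟩
    unit *ᴱ (ψ₀ ^ᴱ k *ᴱ ∏ g others)
      ≡⟨ *ᴱ-assoc unit (ψ₀ ^ᴱ k) (∏ g others) ⟨
    unit *ᴱ ψ₀ ^ᴱ k *ᴱ ∏ g others
      ≡⟨ cong (unit *ᴱ ψ₀ ^ᴱ k *ᴱ_) (∏-filter ((_≟₃ 1₃) ∘ residue) g others) ⟩
    unit *ᴱ ψ₀ ^ᴱ k *ᴱ (∏ g L₁ *ᴱ ∏ g L₂)
      ≡⟨ *ᴱ-assoc (unit *ᴱ ψ₀ ^ᴱ k) (∏ g L₁) (∏ g L₂) ⟨
    unit *ᴱ ψ₀ ^ᴱ k *ᴱ ∏ g L₁ *ᴱ ∏ g L₂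
      ≡⟨ cong₂ (λ p q → unit *ᴱ ψ₀ ^ᴱ k *ᴱ p *ᴱ q) (prodExp≡∏ L₁ exponent) (prodExp≡∏ L₂ exponent) ⟨
    unit *ᴱ ψ₀ ^ᴱ k *ᴱ prodExp L₁ exponent *ᴱ prodExp L₂ exponent
      ∎
    where
    open ≡-Reasoning
    g : 𝔼 → 𝔼
    g ψ = ψ ^ᴱ exponent ψ
    ψ₀-once : filter (_≟ᴱ ψ₀) primes ≡ ψ₀ ∷ []
    ψ₀-once = filter-≟-Unique distinct ψ₀∈primes

mainTheorem2 : (α : 𝔼) → Odd α → NormPerfect α →
    Σ 𝔼 λ ε → Σ 𝔼 λ ψ₀ → Σ ℕ λ k → Σ (List 𝔼) λ L₁ → Σ (List 𝔼) λ L₂ → Σ (𝔼 → ℕ) λ e →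
      IsUnit ε
      × ((InP 1 α ψ₀ × k % 3 ≡ 2) ⊎ (InP 2 α ψ₀ × k % 2 ≡ 1))
      × Enumerates (λ ψ → InP 1 α ψ × ψ ≢ ψ₀) L₁
      × Enumerates (λ ψ → InP 2 α ψ × ψ ≢ ψ₀) L₂
      × α ≡ ε *ᴱ (ψ₀ ^ᴱ k) *ᴱ prodExp L₁ e *ᴱ prodExp L₂ e
      × (∀ ψ → ψ ∈ L₁ → e ψ % 3 ≢ 2)
      × (∀ ψ → ψ ∈ L₂ → e ψ % 2 ≡ 0)
mainTheorem2 α odd (F , perfect) =
  unit , ψ₀ , k , L₁ , L₂ , exponent , unit-unit , ψ₀-class , L₁-enumerates , L₂-enumerates ,
  α-decomposition , L₁-exponents , L₂-exponents
  where
  open Factorization F using (unit; unit-unit)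
  open PrimeFactorization F using (exponent)
  open OddNormPerfect odd F perfect
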